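{- Consider an instance of the weighted Tower of Hanoi with $n\ge 1$ discs, source peg $i$, destination peg $j\neq i$, and third peg $k=6-i-j$. This instance has no optimal solution containing a move of a disc from peg $i$ to peg $j$ if and only if $$w_{ij}>w_{ik}+w_{kj}+\max\{0,\ 2C_{n-1}^{i,j}+C_{n-1}^{j,i}-C_{n-1}^{i,k}-C_{n-1}^{k,j}\}$$ and $$C_n^{i,j}=2C_{n-1}^{i,j}+C_{n-1}^{j,i}+w_{ik}+w_{kj}.$$
   Context: Weighted Tower of Hanoi (WTH): three pegs $1,2,3$, $n\in\mathbb{N}_0$ discs of pairwise distinct diameters. A legal move takes the topmost disc of a peg $a$ to a different peg $b$ which is empty or whose topmost disc is larger; it costs $w_{ab}\ge 0$. An instance $(n,i,j)$, $i\neq j$, asks to transfer all $n$ discs from peg $i$ (initially stacked there) to peg $j$; a solution is a finite sequence of legal moves achieving this, its total cost is the sum of its move costs, and an optimal solution is one of minimum total cost. $C_n^{a,b}$ denotes the minimum total cost of transferring a tower of $n$ discs from peg $a$ to peg $b$, with $C_0^{a,b}=0$.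
   Formalization: The move costs $w_{ab}$ are rational numbers rather than real numbers. -}

module Defs where

open import Data.Nat using (ℕ)
open import Data.Fin using (Fin; _<_)
open import Data.Vec using (Vec; lookup; replicate; _[_]≔_)
open import Data.Rational using (ℚ; _+_; _≤_; 0ℚ)
open import Data.Product using (_×_; ∃)
open import Data.Sum using (_⊎_)
open import Relation.Binary.PropositionalEquality using (_≡_; _≢_)

Peg : Set
Peg = Fin 3

Weights : Set
Weights = Peg → Peg → ℚ

-- A configuration (regular state) of n discs: position of each disc.
-- Disc index 0 is the smallest, larger index = larger diameter.
Config : ℕ → Set
Config n = Vec Peg n

tower : (n : ℕ) → Peg → Config n
tower n a = replicate n a

-- Moving disc d (currently on peg  lookup s d ) to peg b is legal iff
-- b differs from the current peg, and no smaller disc lies on the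
-- source peg (d is topmost) nor on the target peg (b empty or its top larger).
Legal : {n : ℕ} → Config n → Fin n → Peg → Set
Legal {n} s d b =
  (b ≢ lookup s d) ×
  (∀ (e : Fin n) → e < d → (lookup s e ≢ lookup s d) × (lookup s e ≢ b))

data Walk (w : Weights) {n : ℕ} : Config n → Config n → ℚ → Set where
  done : ∀ {s} → Walk w s s 0ℚ
  step : ∀ {s t c} (d : Fin n) (b : Peg) → Legal s d b →
         Walk w (s [ d ]≔ b) t c →
         Walk w s t (w (lookup s d) b + c)

data HasMove (w : Weights) {n : ℕ} (a b : Peg) :
       {s t : Config n} {c : ℚ} → Walk w s t c → Set where
  here  : ∀ {s t c} (d : Fin n) (l : Legal s d b)
          (p : Walk w (s [ d ]≔ b) t c) →
          lookup s d ≡ a → HasMove w a b (step d b l p)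
  there : ∀ {s t c} (d : Fin n) (b' : Peg) (l : Legal s d b')
          (p : Walk w (s [ d ]≔ b') t c) →
          HasMove w a b p → HasMove w a b (step d b' l p)

Optimal : (w : Weights) (n : ℕ) (a b : Peg) {c : ℚ} →
          Walk w (tower n a) (tower n b) c → Set
Optimal w n a b {c} _ = ∀ {c'} → Walk w (tower n a) (tower n b) c' → c ≤ c'

IsMinCost : (w : Weights) (n : ℕ) (a b : Peg) → ℚ → Set
IsMinCost w n a b c =
  ∃ (λ (p : Walk w (tower n a) (tower n b) c) → Optimal w n a b p)

-- Write C m a b for the least cost of moving a tower of m discs from peg a to
-- peg b, and c for the third peg.  With m+1 discs the largest one moves either
-- once (direct: C m a c + w a b + C m c b) or twice, via c (detour:
-- 2 C m a b + C m b a + w a c + w c b), and C (m+1) a b is the smaller of the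
-- two; that no solution is cheaper follows from a potential argument along an
-- arbitrary solution, indexed by the position of the largest disc.
-- If direct ≤ detour for n+1 discs, the direct solution is optimal and moves a
-- disc from i to j.  If detour < direct, then also for fewer discs (once the
-- direct strategy is optimal it stays optimal with one more disc), and by
-- induction on the number of discs a strict form of the potential argument shows
-- that every solution moving a disc from i to j costs more than C (n+1) i j.
-- Finally detour < direct forces C n i k + C n k j ≤ 2 C n i j + C n j i, so the
-- maximum with 0 in the theorem is harmless: its inequality is a rearrangement of
-- detour < direct, and its equation says that C (n+1) i j is the detour cost.

module Submission where

open import Defs
open import Data.Nat using (ℕ; zero; suc)
import Data.Nat as ℕ
import Data.Nat.Properties as ℕₚ
open import Data.Fin using (Fin; zero; suc; toℕ; inject₁; fromℕ)
import Data.Fin as Fin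
open import Data.Fin.Properties using (toℕ-inject₁; toℕ-fromℕ; inject₁ℕ<; fromℕ≢inject₁; _≟_)
open import Data.Fin.Relation.Unary.Top using (view; ‵fromℕ; ‵inject₁)
open import Data.Rational using (ℚ; _+_; _-_; -_; _⊔_; _⊓_; _≤_; _<_; 0ℚ)
import Data.Rational.Properties as ℚ
open import Data.Rational.Solver using (module +-*-Solver)
open +-*-Solver using (solve; _:=_; _:+_; _:-_; :-_)
open import Data.Vec using (Vec; []; _∷_; lookup; replicate; _[_]≔_; _∷ʳ_; initLast)
open import Data.Vec.Properties using (lookup-replicate; ∷ʳ-injective)
open import Data.Empty using (⊥)
open import Data.Product using (_×_; Σ-syntax; ∃-syntax; _,_; proj₁; proj₂)
open import Data.Sum using (_⊎_; inj₁; inj₂)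
open import Function.Bundles using (_⇔_; mk⇔; Equivalence)
open import Relation.Nullary using (¬_; Dec; yes; no; contradiction)
open import Relation.Binary.PropositionalEquality
  using (_≡_; _≢_; refl; sym; trans; cong; cong₂; subst; subst₂; ≢-sym; module ≡-Reasoning)

-- Pegs, vectors and legal moves

pattern peg₁ = zero
pattern peg₂ = suc zero
pattern peg₃ = suc (suc zero)

third : Peg → Peg → Peg
third peg₁ peg₂ = peg₃
third peg₁ peg₃ = peg₂
third peg₂ peg₁ = peg₃
third peg₂ peg₃ = peg₁
third peg₃ peg₁ = peg₂
third peg₃ peg₂ = peg₁
third a    _    = a

third-unique : ∀ {a b c} → a ≢ b → c ≢ a → c ≢ b → c ≡ third a b
third-unique {peg₁} {peg₁} a≢b _ _ = contradiction refl a≢b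
third-unique {peg₂} {peg₂} a≢b _ _ = contradiction refl a≢b
third-unique {peg₃} {peg₃} a≢b _ _ = contradiction refl a≢b
third-unique {peg₁} {_} {peg₁} _ c≢a _ = contradiction refl c≢a
third-unique {peg₂} {_} {peg₂} _ c≢a _ = contradiction refl c≢a
third-unique {peg₃} {_} {peg₃} _ c≢a _ = contradiction refl c≢a
third-unique {_} {peg₁} {peg₁} _ _ c≢b = contradiction refl c≢b
third-unique {_} {peg₂} {peg₂} _ _ c≢b = contradiction refl c≢b
third-unique {_} {peg₃} {peg₃} _ _ c≢b = contradiction refl c≢b
third-unique {peg₁} {peg₂} {peg₃} _ _ _ = refl
third-unique {peg₁} {peg₃} {peg₂} _ _ _ = refl
third-unique {peg₂} {peg₁} {peg₃} _ _ _ = refl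
third-unique {peg₂} {peg₃} {peg₁} _ _ _ = refl
third-unique {peg₃} {peg₁} {peg₂} _ _ _ = refl
third-unique {peg₃} {peg₂} {peg₁} _ _ _ = refl

third-distinct : ∀ {a b} → a ≢ b → third a b ≢ a × third a b ≢ b
third-distinct {peg₁} {peg₁} a≢b = contradiction refl a≢b
third-distinct {peg₂} {peg₂} a≢b = contradiction refl a≢b
third-distinct {peg₃} {peg₃} a≢b = contradiction refl a≢b
third-distinct {peg₁} {peg₂} _ = (λ ()) , (λ ())
third-distinct {peg₁} {peg₃} _ = (λ ()) , (λ ())
third-distinct {peg₂} {peg₁} _ = (λ ()) , (λ ())
third-distinct {peg₂} {peg₃} _ = (λ ()) , (λ ())
third-distinct {peg₃} {peg₁} _ = (λ ()) , (λ ())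
third-distinct {peg₃} {peg₂} _ = (λ ()) , (λ ())

third-≢ˡ : ∀ {a b} → a ≢ b → third a b ≢ a
third-≢ˡ a≢b = proj₁ (third-distinct a≢b)

third-≢ʳ : ∀ {a b} → a ≢ b → third a b ≢ b
third-≢ʳ a≢b = proj₂ (third-distinct a≢b)

module _ {A : Set} where

  replicate-∷ʳ : ∀ n (x : A) → replicate (suc n) x ≡ replicate n x ∷ʳ x
  replicate-∷ʳ zero    x = refl
  replicate-∷ʳ (suc n) x = cong (x ∷_) (replicate-∷ʳ n x)

  lookup-∷ʳ-inject₁ : ∀ {n} (xs : Vec A n) x i → lookup (xs ∷ʳ x) (inject₁ i) ≡ lookup xs i
  lookup-∷ʳ-inject₁ (y ∷ xs) x zero    = refl
  lookup-∷ʳ-inject₁ (y ∷ xs) x (suc i) = lookup-∷ʳ-inject₁ xs x i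

  lookup-∷ʳ-fromℕ : ∀ {n} (xs : Vec A n) x → lookup (xs ∷ʳ x) (fromℕ n) ≡ x
  lookup-∷ʳ-fromℕ []       x = refl
  lookup-∷ʳ-fromℕ (y ∷ xs) x = lookup-∷ʳ-fromℕ xs x

  []≔-∷ʳ-inject₁ : ∀ {n} (xs : Vec A n) x i y → (xs ∷ʳ x) [ inject₁ i ]≔ y ≡ (xs [ i ]≔ y) ∷ʳ x
  []≔-∷ʳ-inject₁ (z ∷ xs) x zero    y = refl
  []≔-∷ʳ-inject₁ (z ∷ xs) x (suc i) y = cong (z ∷_) ([]≔-∷ʳ-inject₁ xs x i y)

  []≔-∷ʳ-fromℕ : ∀ {n} (xs : Vec A n) x y → (xs ∷ʳ x) [ fromℕ n ]≔ y ≡ xs ∷ʳ y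
  []≔-∷ʳ-fromℕ []       x y = refl
  []≔-∷ʳ-fromℕ (z ∷ xs) x y = cong (z ∷_) ([]≔-∷ʳ-fromℕ xs x y)

  lookup-const⇒replicate : ∀ {n} (xs : Vec A n) x → (∀ i → lookup xs i ≡ x) → xs ≡ replicate n x
  lookup-const⇒replicate []       x _ = refl
  lookup-const⇒replicate (y ∷ xs) x h = cong₂ _∷_ (h zero) (lookup-const⇒replicate xs x (λ i → h (suc i)))

module _ {n : ℕ} where

  <-inject₁⁻¹ : ∀ {e : Fin (suc n)} {d : Fin n} → e Fin.< inject₁ d → ∃[ e′ ] e ≡ inject₁ e′ × e′ Fin.< d
  <-inject₁⁻¹ {e} {d} e<d with view e
  ... | ‵fromℕ = contradiction (subst₂ ℕ._<_ (toℕ-fromℕ n) refl e<d) (ℕₚ.<-asym (inject₁ℕ< d))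
  ... | ‵inject₁ e′ = e′ , refl , subst₂ ℕ._<_ (toℕ-inject₁ e′) (toℕ-inject₁ d) e<d

  inject₁-mono-< : ∀ {e d : Fin n} → e Fin.< d → inject₁ e Fin.< inject₁ d
  inject₁-mono-< {e} {d} = subst₂ ℕ._<_ (sym (toℕ-inject₁ e)) (sym (toℕ-inject₁ d))

  <-fromℕ⁻¹ : ∀ {e : Fin (suc n)} → e Fin.< fromℕ n → ∃[ e′ ] e ≡ inject₁ e′
  <-fromℕ⁻¹ {e} e<n with view e
  ... | ‵fromℕ = contradiction e<n (ℕₚ.<-irrefl refl)
  ... | ‵inject₁ e′ = e′ , refl

  inject₁<fromℕ : ∀ (e : Fin n) → inject₁ e Fin.< fromℕ n
  inject₁<fromℕ e = subst (toℕ (inject₁ e) ℕ.<_) (sym (toℕ-fromℕ n)) (inject₁ℕ< e)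

module _ {n : ℕ} (s : Config n) (x : Peg) {d : Fin n} {b : Peg} where

  Legal-∷ʳ : Legal s d b → Legal (s ∷ʳ x) (inject₁ d) b
  Legal-∷ʳ (b≢sd , free) rewrite lookup-∷ʳ-inject₁ s x d = b≢sd , free′
    where
    free′ : ∀ e → e Fin.< inject₁ d → (lookup (s ∷ʳ x) e ≢ lookup s d) × (lookup (s ∷ʳ x) e ≢ b)
    free′ e e<d with <-inject₁⁻¹ e<d
    ... | e′ , refl , e′<d rewrite lookup-∷ʳ-inject₁ s x e′ = free e′ e′<d

  Legal-∷ʳ⁻¹ : Legal (s ∷ʳ x) (inject₁ d) b → Legal s d b
  Legal-∷ʳ⁻¹ (b≢sd , free) rewrite lookup-∷ʳ-inject₁ s x d = b≢sd , free′
    where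
    free′ : ∀ e → e Fin.< d → (lookup s e ≢ lookup s d) × (lookup s e ≢ b)
    free′ e e<d with free (inject₁ e) (inject₁-mono-< e<d)
    ... | h rewrite lookup-∷ʳ-inject₁ s x e = h

module _ {n : ℕ} {x y : Peg} where

  Legal-largest : ∀ {t} → x ≢ y → t ≢ x → t ≢ y → Legal (replicate n t ∷ʳ x) (fromℕ n) y
  Legal-largest {t} x≢y t≢x t≢y rewrite lookup-∷ʳ-fromℕ (replicate n t) x = ≢-sym x≢y , free
    where
    free : ∀ e → e Fin.< fromℕ n → (lookup (replicate n t ∷ʳ x) e ≢ x) × (lookup (replicate n t ∷ʳ x) e ≢ y)
    free e e<n with <-fromℕ⁻¹ e<n
    ... | e′ , refl rewrite lookup-∷ʳ-inject₁ (replicate n t) x e′ | lookup-replicate e′ t = t≢x , t≢y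

  Legal-largest⁻¹ : ∀ {s : Config n} → Legal (s ∷ʳ x) (fromℕ n) y → x ≢ y × s ≡ replicate n (third x y)
  Legal-largest⁻¹ {s} (y≢x , free) rewrite lookup-∷ʳ-fromℕ s x =
    ≢-sym y≢x , lookup-const⇒replicate s (third x y) on-third
    where
    on-third : ∀ e → lookup s e ≡ third x y
    on-third e with free (inject₁ e) (inject₁<fromℕ e)
    ... | h rewrite lookup-∷ʳ-inject₁ s x e = third-unique (≢-sym y≢x) (proj₁ h) (proj₂ h)

p≤p+q : ∀ p {q} → 0ℚ ≤ q → p ≤ p + q
p≤p+q p {q} 0≤q = subst (_≤ p + q) (ℚ.+-identityʳ p) (ℚ.+-monoʳ-≤ p 0≤q)

p≤q+p : ∀ p {q} → 0ℚ ≤ q → p ≤ q + p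
p≤q+p p {q} 0≤q = subst (_≤ q + p) (ℚ.+-identityˡ p) (ℚ.+-monoˡ-≤ p 0≤q)

+-nonneg : ∀ {p q} → 0ℚ ≤ p → 0ℚ ≤ q → 0ℚ ≤ p + q
+-nonneg {p} 0≤p 0≤q = ℚ.≤-trans 0≤p (p≤p+q p 0≤q)

+-cancelʳ-< : ∀ p q r → p + r < q + r → p < q
+-cancelʳ-< p q r p+r<q+r = subst₂ _<_ (+-r-r p) (+-r-r q) (ℚ.+-monoˡ-< (- r) p+r<q+r)
  where
  +-r-r : ∀ x → x + r + - r ≡ x
  +-r-r x = solve 2 (λ X R → X :+ R :+ (:- R) := X) refl x r

x≤p+q⇒x<p+r+q : ∀ {x} p q {r} → x ≤ p + q → 0ℚ < r → x < p + r + q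
x≤p+q⇒x<p+r+q {x} p q {r} x≤p+q 0<r =
  ℚ.≤-<-trans x≤p+q (subst₂ _<_ (ℚ.+-identityˡ (p + q)) r+[p+q]≡p+r+q (ℚ.+-monoˡ-< (p + q) 0<r))
  where
  r+[p+q]≡p+r+q : r + (p + q) ≡ p + r + q
  r+[p+q]≡p+r+q = solve 3 (λ P Q R → R :+ (P :+ Q) := P :+ R :+ Q) refl p q r

p+q≤r⇒0≤r-p-q : ∀ {p q r} → p + q ≤ r → 0ℚ ≤ r - p - q
p+q≤r⇒0≤r-p-q {p} {q} {r} p+q≤r =
  subst₂ _≤_ (ℚ.+-inverseʳ (p + q)) r-[p+q]≡r-p-q (ℚ.+-monoˡ-≤ (- (p + q)) p+q≤r)
  where
  r-[p+q]≡r-p-q : r - (p + q) ≡ r - p - q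
  r-[p+q]≡r-p-q = solve 3 (λ P Q R → R :- (P :+ Q) := R :- P :- Q) refl p q r

<-⊓ : ∀ {x} (f : ℚ → ℚ) p q → x < f p → x < f q → x < f (p ⊓ q)
<-⊓ {x} f p q x<fp x<fq with ℚ.⊓-sel p q
... | inj₁ p⊓q≡p = subst (λ u → x < f u) (sym p⊓q≡p) x<fp
... | inj₂ p⊓q≡q = subst (λ u → x < f u) (sym p⊓q≡q) x<fq

-- A step records the configuration it leads to only up to a propositional
-- equation, so that paths can be assembled without transporting along
-- vector identities.
data Path {n : ℕ} : Config n → Config n → Set where
  done : ∀ {s} → Path s s
  step : ∀ {s s′ t} (d : Fin n) (b : Peg) → Legal s d b → s [ d ]≔ b ≡ s′ → Path s′ t → Path s t

module _ {n : ℕ} where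

  infixr 5 _++_
  _++_ : ∀ {s t u : Config n} → Path s t → Path t u → Path s u
  done           ++ q = q
  step d b l e p ++ q = step d b l e (p ++ q)

  HasStep : ∀ {s t : Config n} → Peg → Peg → Path s t → Set
  HasStep a b done                   = ⊥
  HasStep a b (step {s} d b′ _ _ p) = (lookup s d ≡ a × b′ ≡ b) ⊎ HasStep a b p

  HasStep-++ˡ : ∀ {s t u : Config n} {a b} (p : Path s t) (q : Path t u) → HasStep a b p → HasStep a b (p ++ q)
  HasStep-++ˡ (step d b l e p) q (inj₁ h) = inj₁ h
  HasStep-++ˡ (step d b l e p) q (inj₂ h) = inj₂ (HasStep-++ˡ p q h)

  HasStep-++ʳ : ∀ {s t u : Config n} {a b} (p : Path s t) (q : Path t u) → HasStep a b q → HasStep a b (p ++ q)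
  HasStep-++ʳ done             q h = h
  HasStep-++ʳ (step d b l e p) q h = inj₂ (HasStep-++ʳ p q h)

lift : ∀ {n} {s t : Config n} {S T : Config (suc n)} {x} → Path s t → S ≡ s ∷ʳ x → T ≡ t ∷ʳ x → Path S T
lift done                 refl refl = done
lift {x = x} (step {s} d b l e p) refl eT =
  step (inject₁ d) b (Legal-∷ʳ s x l) (trans ([]≔-∷ʳ-inject₁ s x d b) (cong (_∷ʳ x) e)) (lift p refl eT)

move-largest : ∀ {n x y t} → x ≢ y → t ≢ x → t ≢ y → Path {suc n} (replicate n t ∷ʳ x) (replicate n t ∷ʳ y)
move-largest {n} {x} {y} {t} x≢y t≢x t≢y =
  step (fromℕ n) y (Legal-largest x≢y t≢x t≢y) ([]≔-∷ʳ-fromℕ (replicate n t) x y) done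

HasStep-move-largest : ∀ {n x y t} (x≢y : x ≢ y) (t≢x : t ≢ x) (t≢y : t ≢ y) →
                       HasStep x y (move-largest {n} x≢y t≢x t≢y)
HasStep-move-largest {n} {x} {t = t} _ _ _ = inj₁ (lookup-∷ʳ-fromℕ (replicate n t) x , refl)

HasSmallStep : ∀ {m} {S T : Config (suc m)} → Peg → Peg → Path S T → Set
HasSmallStep a b done                   = ⊥
HasSmallStep a b (step {s} d b′ _ _ p) = (d ≢ fromℕ _ × lookup s d ≡ a × b′ ≡ b) ⊎ HasSmallStep a b p

module _ (w : Weights) where

  cost : ∀ {n} {s t : Config n} → Path s t → ℚ
  cost done                   = 0ℚ
  cost (step {s} d b _ _ p) = w (lookup s d) b + cost p

  cost-++ : ∀ {n} {s t u : Config n} (p : Path s t) (q : Path t u) → cost (p ++ q) ≡ cost p + cost q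
  cost-++ done                 q = sym (ℚ.+-identityˡ (cost q))
  cost-++ (step {s} d b l e p) q = trans (cong (w (lookup s d) b +_) (cost-++ p q))
                                         (sym (ℚ.+-assoc (w (lookup s d) b) (cost p) (cost q)))

  cost-lift : ∀ {n} {s t : Config n} {S T : Config (suc n)} {x} (p : Path s t) (eS : S ≡ s ∷ʳ x) (eT : T ≡ t ∷ʳ x) →
              cost (lift p eS eT) ≡ cost p
  cost-lift         done                 refl refl = refl
  cost-lift {x = x} (step {s} d b l e p) refl eT   =
    cong₂ (λ a c → w a b + c) (lookup-∷ʳ-inject₁ s x d) (cost-lift p refl eT)

  cost-move-largest : ∀ {n x y t} (x≢y : x ≢ y) (t≢x : t ≢ x) (t≢y : t ≢ y) →
                      cost (move-largest {n} x≢y t≢x t≢y) ≡ w x y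
  cost-move-largest {n} {x} {y} {t} _ _ _ =
    trans (cong (λ a → w a y + 0ℚ) (lookup-∷ʳ-fromℕ (replicate n t) x)) (ℚ.+-identityʳ (w x y))

  toWalk : ∀ {n} {s t : Config n} (p : Path s t) → Walk w s t (cost p)
  toWalk done                  = done
  toWalk (step d b l refl p) = step d b l (toWalk p)

  HasMove-toWalk : ∀ {n} {s t : Config n} {a b} (p : Path s t) → HasStep a b p → HasMove w a b (toWalk p)
  HasMove-toWalk (step d b l refl p) (inj₁ (sd≡a , refl)) = here d l (toWalk p) sd≡a
  HasMove-toWalk (step d b l refl p) (inj₂ h)              = there d b l (toWalk p) (HasMove-toWalk p h)

  fromWalk : ∀ {n} {s t : Config n} {c} → Walk w s t c → Path s t
  fromWalk done           = done
  fromWalk (step d b l p) = step d b l refl (fromWalk p)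

  cost-fromWalk : ∀ {n} {s t : Config n} {c} (p : Walk w s t c) → cost (fromWalk p) ≡ c
  cost-fromWalk done               = refl
  cost-fromWalk (step {s} d b l p) = cong (w (lookup s d) b +_) (cost-fromWalk p)

  HasStep-fromWalk : ∀ {n} {s t : Config n} {c a b} (p : Walk w s t c) → HasMove w a b p → HasStep a b (fromWalk p)
  HasStep-fromWalk (step d b l p) (here _ _ _ sd≡a)  = inj₁ (sd≡a , refl)
  HasStep-fromWalk (step d b l p) (there _ _ _ _ h) = inj₂ (HasStep-fromWalk p h)

  -- The recursion for the least cost

  direct detour : (Peg → Peg → ℚ) → Peg → Peg → Peg → Peg → Peg → ℚ
  direct P x z y b c = P z c + w x y + P c b
  detour P x z y b c = P z y + w x c + P y x + w c y + P x b

  -- Cˢ P x z y b is the cost of going from "largest disc on x, the others on z"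
  -- to "largest disc on y, the others on b" when P prices the moves of the
  -- smaller tower; with c the third peg of x and y, the largest disc moves once
  -- (direct) or twice, via c (detour).
  Cˢ : (Peg → Peg → ℚ) → Peg → Peg → Peg → Peg → ℚ
  Cˢ P x z y b with x ≟ y
  ... | yes _ = P z b
  ... | no  _ = direct P x z y b (third x y) ⊓ detour P x z y b (third x y)

  Cˢ-≡ : ∀ P y z b → Cˢ P y z y b ≡ P z b
  Cˢ-≡ P y z b with y ≟ y
  ... | yes _   = refl
  ... | no  y≢y = contradiction refl y≢y

  Cˢ-≢ : ∀ P {x y c} z b → x ≢ y → c ≢ x → c ≢ y → Cˢ P x z y b ≡ direct P x z y b c ⊓ detour P x z y b c
  Cˢ-≢ P {x} {y} z b x≢y c≢x c≢y with x ≟ y | third-unique x≢y c≢x c≢y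
  ... | yes x≡y | _    = contradiction x≡y x≢y
  ... | no  _   | refl = refl

  C : ℕ → Peg → Peg → ℚ
  C zero    _ _ = 0ℚ
  C (suc m) a b = Cˢ (C m) a a b b

  C-diag : ∀ m a → C m a a ≡ 0ℚ
  C-diag zero    a = refl
  C-diag (suc m) a = trans (Cˢ-≡ (C m) a a a) (C-diag m a)

  C-suc : ∀ m {a b c} → a ≢ b → c ≢ a → c ≢ b →
          C (suc m) a b ≡ direct (C m) a a b b c ⊓ detour (C m) a a b b c
  C-suc m = Cˢ-≢ (C m) _ _

  module _ {m : ℕ} {a b : Peg} (a≢b : a ≢ b) where

    private
      c = third a b
      c≢a = third-≢ˡ a≢b
      c≢b = third-≢ʳ a≢b

    direct-path : Path (tower m a) (tower m c) → Path (tower m c) (tower m b) →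
                  Path (tower (suc m) a) (tower (suc m) b)
    direct-path p q = lift p (replicate-∷ʳ m a) refl ++ move-largest a≢b c≢a c≢b ++ lift q refl (replicate-∷ʳ m b)

    cost-direct-path : ∀ p q → cost (direct-path p q) ≡ cost p + w a b + cost q
    cost-direct-path p q = begin
      cost (P₁ ++ M ++ P₂)           ≡⟨ trans (cost-++ P₁ (M ++ P₂)) (cong (cost P₁ +_) (cost-++ M P₂)) ⟩
      cost P₁ + (cost M + cost P₂)   ≡⟨ cong₂ _+_ (cost-lift p (replicate-∷ʳ m a) refl)
                                          (cong₂ _+_ (cost-move-largest {m} a≢b c≢a c≢b)
                                                     (cost-lift q refl (replicate-∷ʳ m b))) ⟩
      cost p + (w a b + cost q)      ≡⟨ ℚ.+-assoc (cost p) (w a b) (cost q) ⟨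
      cost p + w a b + cost q        ∎
      where
      open ≡-Reasoning
      P₁ = lift p (replicate-∷ʳ m a) refl
      M  = move-largest {m} a≢b c≢a c≢b
      P₂ = lift q refl (replicate-∷ʳ m b)

    HasStep-direct-path : ∀ p q → HasStep a b (direct-path p q)
    HasStep-direct-path p q = HasStep-++ʳ (lift p (replicate-∷ʳ m a) refl) _
      (HasStep-++ˡ (move-largest a≢b c≢a c≢b) _ (HasStep-move-largest {m} a≢b c≢a c≢b))

    detour-path : Path (tower m a) (tower m b) → Path (tower m b) (tower m a) → Path (tower m a) (tower m b) →
                  Path (tower (suc m) a) (tower (suc m) b)
    detour-path p q r =
      lift p (replicate-∷ʳ m a) refl ++ move-largest (≢-sym c≢a) (≢-sym a≢b) (≢-sym c≢b) ++
      lift q refl refl ++ move-largest c≢b (≢-sym c≢a) a≢b ++ lift r refl (replicate-∷ʳ m b)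

    cost-detour-path : ∀ p q r → cost (detour-path p q r) ≡ cost p + w a c + cost q + w c b + cost r
    cost-detour-path p q r = begin
      cost (P₁ ++ M₁ ++ P₂ ++ M₂ ++ P₃)
        ≡⟨ trans (cost-++ P₁ (M₁ ++ P₂ ++ M₂ ++ P₃)) (cong (cost P₁ +_) (trans (cost-++ M₁ (P₂ ++ M₂ ++ P₃))
             (cong (cost M₁ +_) (trans (cost-++ P₂ (M₂ ++ P₃)) (cong (cost P₂ +_) (cost-++ M₂ P₃)))))) ⟩
      cost P₁ + (cost M₁ + (cost P₂ + (cost M₂ + cost P₃)))
        ≡⟨ cong₂ _+_ (cost-lift p (replicate-∷ʳ m a) refl)
             (cong₂ _+_ (cost-move-largest {m} (≢-sym c≢a) (≢-sym a≢b) (≢-sym c≢b))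
               (cong₂ _+_ (cost-lift q refl refl)
                 (cong₂ _+_ (cost-move-largest {m} c≢b (≢-sym c≢a) a≢b) (cost-lift r refl (replicate-∷ʳ m b))))) ⟩
      cost p + (w a c + (cost q + (w c b + cost r)))
        ≡⟨ solve 5 (λ A B D E F → A :+ (B :+ (D :+ (E :+ F))) := A :+ B :+ D :+ E :+ F)
             refl (cost p) (w a c) (cost q) (w c b) (cost r) ⟩
      cost p + w a c + cost q + w c b + cost r
        ∎
      where
      open ≡-Reasoning
      P₁ = lift p (replicate-∷ʳ m a) refl
      M₁ = move-largest {m} (≢-sym c≢a) (≢-sym a≢b) (≢-sym c≢b)
      P₂ = lift q refl refl
      M₂ = move-largest {m} c≢b (≢-sym c≢a) a≢b
      P₃ = lift r refl (replicate-∷ʳ m b)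

  LowerBound : ℕ → (Peg → Peg → ℚ) → Set
  LowerBound m P = ∀ {a b} (q : Path (tower m a) (tower m b)) → P a b ≤ cost q

  StrictLowerBound : Peg → Peg → ℕ → (Peg → Peg → ℚ) → Set
  StrictLowerBound i j m P = ∀ {a b} (q : Path (tower m a) (tower m b)) → HasStep i j q → P a b < cost q

  C-attained : ∀ m a b → Σ[ p ∈ Path (tower m a) (tower m b) ] cost p ≡ C m a b
  C-attained zero    a b = done , refl
  C-attained (suc m) a b = by-cases (a ≟ b)
    where
    open ≡-Reasoning
    c = third a b
    optimal : ∀ a b → Path (tower m a) (tower m b)
    optimal a b = proj₁ (C-attained m a b)
    optimal-cost : ∀ a b → cost (optimal a b) ≡ C m a b
    optimal-cost a b = proj₂ (C-attained m a b)

    by-cases : Dec (a ≡ b) → Σ[ p ∈ Path (tower (suc m) a) (tower (suc m) b) ] cost p ≡ C (suc m) a b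
    by-cases (yes refl) = done , sym (C-diag (suc m) a)
    by-cases (no a≢b) with ℚ.⊓-sel (direct (C m) a a b b c) (detour (C m) a a b b c)
    ... | inj₁ min≡direct = direct-path a≢b (optimal a c) (optimal c b) , (begin
      cost (direct-path a≢b (optimal a c) (optimal c b))
        ≡⟨ cost-direct-path a≢b (optimal a c) (optimal c b) ⟩
      cost (optimal a c) + w a b + cost (optimal c b)
        ≡⟨ cong₂ (λ u v → u + w a b + v) (optimal-cost a c) (optimal-cost c b) ⟩
      direct (C m) a a b b c
        ≡⟨ trans (C-suc m a≢b (third-≢ˡ a≢b) (third-≢ʳ a≢b)) min≡direct ⟨
      C (suc m) a b ∎)
    ... | inj₂ min≡detour = detour-path a≢b (optimal a b) (optimal b a) (optimal a b) , (begin
      cost (detour-path a≢b (optimal a b) (optimal b a) (optimal a b))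
        ≡⟨ cost-detour-path a≢b (optimal a b) (optimal b a) (optimal a b) ⟩
      cost (optimal a b) + w a c + cost (optimal b a) + w c b + cost (optimal a b)
        ≡⟨ cong₂ (λ u v → u + w a c + v + w c b + u) (optimal-cost a b) (optimal-cost b a) ⟩
      detour (C m) a a b b c
        ≡⟨ trans (C-suc m a≢b (third-≢ˡ a≢b) (third-≢ʳ a≢b)) min≡detour ⟨
      C (suc m) a b ∎)

  optimal-path : ∀ m a b → Path (tower m a) (tower m b)
  optimal-path m a b = proj₁ (C-attained m a b)

  cost-optimal-path : ∀ m a b → cost (optimal-path m a b) ≡ C m a b
  cost-optimal-path m a b = proj₂ (C-attained m a b)

  module _ (w≥0 : ∀ a b → a ≢ b → 0ℚ ≤ w a b) where

    w-legal-nonneg : ∀ {n} {s : Config n} {d b} → Legal s d b → 0ℚ ≤ w (lookup s d) b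
    w-legal-nonneg {s = s} {d} {b} (b≢sd , _) = w≥0 (lookup s d) b (≢-sym b≢sd)

    cost-nonneg : ∀ {n} {s t : Config n} (p : Path s t) → 0ℚ ≤ cost p
    cost-nonneg done               = ℚ.≤-refl
    cost-nonneg (step {s} d b l e p) = +-nonneg (w-legal-nonneg {s = s} l) (cost-nonneg p)

    C-nonneg : ∀ m a b → 0ℚ ≤ C m a b
    C-nonneg m a b = subst (0ℚ ≤_) (cost-optimal-path m a b) (cost-nonneg (optimal-path m a b))

    module _ (P : Peg → Peg → ℚ) (P-nonneg : ∀ a b → 0ℚ ≤ P a b)
             (P-triangle : ∀ a b c → P a c ≤ P a b + P b c) where

      Cˢ-≥ : ∀ x z y b → P z b ≤ Cˢ P x z y b
      Cˢ-≥ x z y b with x ≟ y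
      ... | yes refl = ℚ.≤-refl
      ... | no  x≢y  = ℚ.⊓-glb via-third via-y
        where
        open ℚ.≤-Reasoning
        c = third x y
        via-third : P z b ≤ direct P x z y b c
        via-third = begin
          P z b                 ≤⟨ P-triangle z c b ⟩
          P z c + P c b         ≤⟨ ℚ.+-monoˡ-≤ (P c b) (p≤p+q (P z c) (w≥0 x y x≢y)) ⟩
          P z c + w x y + P c b ∎
        via-y : P z b ≤ detour P x z y b c
        via-y = begin
          P z b                                    ≤⟨ P-triangle z y b ⟩
          P z y + P y b                            ≤⟨ ℚ.+-monoʳ-≤ (P z y) (P-triangle y x b) ⟩
          P z y + (P y x + P x b)                  ≤⟨ ℚ.+-monoʳ-≤ (P z y)
                                                        (ℚ.+-mono-≤ (p≤q+p (P y x) wxc≥0) (p≤q+p (P x b) wcy≥0)) ⟩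
          P z y + (w x c + P y x + (w c y + P x b)) ≡⟨ solve 5 (λ A B D E F → A :+ (B :+ D :+ (E :+ F)) := A :+ B :+ D :+ E :+ F)
                                                        refl (P z y) (w x c) (P y x) (w c y) (P x b) ⟩
          detour P x z y b c                       ∎
          where
          wxc≥0 = w≥0 x c (≢-sym (third-≢ˡ x≢y))
          wcy≥0 = w≥0 c y (third-≢ʳ x≢y)

      direct⊓detour-step : ∀ {x y c} z b → x ≢ c →
                           direct P x z y b c ⊓ detour P x z y b c ≤ P z y + w x c + (direct P c y y b x ⊓ detour P c y y b x)
      direct⊓detour-step {x} {y} {c} z b x≢c with ℚ.⊓-sel (direct P c y y b x) (detour P c y y b x)
      ... | inj₁ min≡direct = begin
        direct P x z y b c ⊓ detour P x z y b c        ≤⟨ ℚ.p⊓q≤q (direct P x z y b c) (detour P x z y b c) ⟩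
        P z y + w x c + P y x + w c y + P x b           ≡⟨ solve 5 (λ A B D E F → A :+ B :+ D :+ E :+ F := A :+ B :+ (D :+ E :+ F))
                                                             refl (P z y) (w x c) (P y x) (w c y) (P x b) ⟩
        P z y + w x c + direct P c y y b x              ≡⟨ cong (P z y + w x c +_) min≡direct ⟨
        P z y + w x c + (direct P c y y b x ⊓ detour P c y y b x) ∎
        where open ℚ.≤-Reasoning
      ... | inj₂ min≡detour = begin
        direct P x z y b c ⊓ detour P x z y b c        ≤⟨ ℚ.p⊓q≤p (direct P x z y b c) (detour P x z y b c) ⟩
        P z c + w x y + P c b                           ≤⟨ ℚ.+-monoˡ-≤ (P c b) (ℚ.+-monoˡ-≤ (w x y) (P-triangle z y c)) ⟩
        P z y + P y c + w x y + P c b                   ≤⟨ p≤q+p _ detour-weights≥0 ⟩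
        w x c + P y y + w c x + (P z y + P y c + w x y + P c b)
          ≡⟨ solve 7 (λ A B D E F G H → A :+ B :+ D :+ (E :+ F :+ G :+ H) := E :+ A :+ (B :+ D :+ F :+ G :+ H))
                refl (w x c) (P y y) (w c x) (P z y) (P y c) (w x y) (P c b) ⟩
        P z y + w x c + detour P c y y b x              ≡⟨ cong (P z y + w x c +_) min≡detour ⟨
        P z y + w x c + (direct P c y y b x ⊓ detour P c y y b x) ∎
        where
        open ℚ.≤-Reasoning
        detour-weights≥0 = +-nonneg (+-nonneg (w≥0 x c x≢c) (P-nonneg y y)) (w≥0 c x (≢-sym x≢c))

      Cˢ-step : ∀ {x x′} z y b → x ≢ x′ → Cˢ P x z y b ≤ P z (third x x′) + w x x′ + Cˢ P x′ (third x x′) y b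
      Cˢ-step {x} {x′} z y b x≢x′ with x ≟ y
      ... | yes refl = begin
        P z b                            ≤⟨ P-triangle z t b ⟩
        P z t + P t b                    ≤⟨ ℚ.+-mono-≤ (p≤p+q (P z t) (w≥0 x x′ x≢x′)) (Cˢ-≥ x′ t x b) ⟩
        P z t + w x x′ + Cˢ P x′ t x b   ∎
        where
        open ℚ.≤-Reasoning
        t = third x x′
      ... | no x≢y with x′ ≟ y
      ...   | yes refl = ℚ.p⊓q≤p (direct P x z x′ b (third x x′)) (detour P x z x′ b (third x x′))
      ...   | no x′≢y with third-unique x≢y (≢-sym x≢x′) x′≢y
      ...     | refl rewrite sym (third-unique x≢x′ (≢-sym x≢y) (≢-sym x′≢y)) | sym (third-unique x′≢y x≢x′ x≢y) =
        direct⊓detour-step z b x≢x′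

    -- Lower bounds by a potential argument

    -- f x z bounds the cost from "largest disc on x, the others on z" to
    -- "largest disc on y, the others on b" from below.  Along a path the moves
    -- of the smaller discs made so far are collected in q, and the hypotheses
    -- are the Bellman inequalities for the final state and for a move of the
    -- largest disc.
    module Potential {m : ℕ} (P : Peg → Peg → ℚ) (P-lower : LowerBound m P)
                     (f : Peg → Peg → ℚ) {y b : Peg}
                     (f-final : ∀ z → f y z ≤ P z b)
                     (f-step : ∀ {x x′} z → x ≢ x′ → f x z ≤ P z (third x x′) + w x x′ + f x′ (third x x′)) where

      private
        small-step : ∀ (s : Config m) x {d b′} → Legal (s ∷ʳ x) (inject₁ d) b′ → Path s (s [ d ]≔ b′)
        small-step s x {d} {b′} l = step d b′ (Legal-∷ʳ⁻¹ s x l) refl done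

        cost-small-step : ∀ (s : Config m) x {d b′ z} (l : Legal (s ∷ʳ x) (inject₁ d) b′)
                          (q : Path (tower m z) s) (c : ℚ) →
                          cost (q ++ small-step s x l) + c ≡ cost q + (w (lookup (s ∷ʳ x) (inject₁ d)) b′ + c)
        cost-small-step s x {d} {b′} l q c = begin
          cost (q ++ small-step s x l) + c     ≡⟨ cong (_+ c) (cost-++ q (small-step s x l)) ⟩
          cost q + (w (lookup s d) b′ + 0ℚ) + c ≡⟨ cong (λ u → cost q + u + c) (ℚ.+-identityʳ (w (lookup s d) b′)) ⟩
          cost q + w (lookup s d) b′ + c        ≡⟨ ℚ.+-assoc (cost q) (w (lookup s d) b′) c ⟩
          cost q + (w (lookup s d) b′ + c)      ≡⟨ cong (λ u → cost q + (w u b′ + c)) (lookup-∷ʳ-inject₁ s x d) ⟨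
          cost q + (w (lookup (s ∷ʳ x) (inject₁ d)) b′ + c) ∎
          where open ≡-Reasoning

        cost-large-step : ∀ {t x b′ z} (q : Path (tower m z) (tower m t)) (c : ℚ) →
                          cost q + w x b′ + c ≡ cost q + (w (lookup (tower m t ∷ʳ x) (fromℕ m)) b′ + c)
        cost-large-step {t} {x} {b′} q c = trans (ℚ.+-assoc (cost q) (w x b′) c)
          (cong (λ u → cost q + (w u b′ + c)) (sym (lookup-∷ʳ-fromℕ (tower m t) x)))

      potential-bound : ∀ {S T : Config (suc m)} (p : Path S T) {s x z} → S ≡ s ∷ʳ x → T ≡ tower m b ∷ʳ y →
                        (q : Path (tower m z) s) → f x z ≤ cost q + cost p
      potential-bound done {s} {z = z} eS eT q with ∷ʳ-injective s (tower m b) (trans (sym eS) eT)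
      ... | refl , refl = begin
        f y z         ≤⟨ f-final z ⟩
        P z b         ≤⟨ P-lower q ⟩
        cost q        ≡⟨ ℚ.+-identityʳ (cost q) ⟨
        cost q + 0ℚ   ∎
        where open ℚ.≤-Reasoning
      potential-bound (step d b′ l e p) {s} {x} refl eT q with view d
      ... | ‵inject₁ d′ =
        ℚ.≤-trans (potential-bound p (trans (sym e) ([]≔-∷ʳ-inject₁ s x d′ b′)) eT (q ++ small-step s x l))
                  (ℚ.≤-reflexive (cost-small-step s x l q (cost p)))
      ... | ‵fromℕ with Legal-largest⁻¹ {x = x} {s = s} l
      ...   | x≢b′ , refl = begin
        f x _                     ≤⟨ f-step _ x≢b′ ⟩
        P _ t + w x b′ + f b′ t   ≤⟨ ℚ.+-mono-≤ (ℚ.+-monoˡ-≤ (w x b′) (P-lower q)) rest ⟩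
        cost q + w x b′ + cost p  ≡⟨ cost-large-step q (cost p) ⟩
        cost q + (w (lookup (tower m t ∷ʳ x) (fromℕ m)) b′ + cost p) ∎
        where
        open ℚ.≤-Reasoning
        t = third x b′
        rest : f b′ t ≤ cost p
        rest = subst (f b′ t ≤_) (ℚ.+-identityˡ (cost p))
                 (potential-bound p (trans (sym e) ([]≔-∷ʳ-fromℕ (tower m t) x b′)) eT done)

      module _ {i j : Peg} (P-strict : StrictLowerBound i j m P) where

        potential-bound-strict : ∀ {S T : Config (suc m)} (p : Path S T) {s x z} → S ≡ s ∷ʳ x → T ≡ tower m b ∷ʳ y →
                                 (q : Path (tower m z) s) → HasStep i j q ⊎ HasSmallStep i j p → f x z < cost q + cost p
        potential-bound-strict done {s} {z = z} eS eT q (inj₁ h) with ∷ʳ-injective s (tower m b) (trans (sym eS) eT)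
        ... | refl , refl = begin-strict
          f y z         ≤⟨ f-final z ⟩
          P z b         <⟨ P-strict q h ⟩
          cost q        ≡⟨ ℚ.+-identityʳ (cost q) ⟨
          cost q + 0ℚ   ∎
          where open ℚ.≤-Reasoning
        potential-bound-strict (step d b′ l e p) {s} {x} refl eT q h with view d
        ... | ‵inject₁ d′ =
          ℚ.<-≤-trans (potential-bound-strict p (trans (sym e) ([]≔-∷ʳ-inject₁ s x d′ b′)) eT
                                              (q ++ small-step s x l) (moved h))
                      (ℚ.≤-reflexive (cost-small-step s x l q (cost p)))
          where
          moved : HasStep i j q ⊎ HasSmallStep i j (step (inject₁ d′) b′ l e p) →
                  HasStep i j (q ++ small-step s x l) ⊎ HasSmallStep i j p
          moved (inj₁ hq)                      = inj₁ (HasStep-++ˡ q (small-step s x l) hq)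
          moved (inj₂ (inj₁ (_ , sd≡i , b′≡j))) =
            inj₁ (HasStep-++ʳ q (small-step s x l) (inj₁ (trans (sym (lookup-∷ʳ-inject₁ s x d′)) sd≡i , b′≡j)))
          moved (inj₂ (inj₂ hp))               = inj₂ hp
        ... | ‵fromℕ with Legal-largest⁻¹ {x = x} {s = s} l
        ...   | x≢b′ , refl =
          ℚ.≤-<-trans (f-step _ x≢b′) (ℚ.<-≤-trans (strict h) (ℚ.≤-reflexive (cost-large-step q (cost p))))
          where
          t = third x b′
          e′ = trans (sym e) ([]≔-∷ʳ-fromℕ (tower m t) x b′)
          strict : HasStep i j q ⊎ HasSmallStep i j (step (fromℕ m) b′ l e p) →
                   P _ t + w x b′ + f b′ t < cost q + w x b′ + cost p
          strict (inj₁ hq) = ℚ.+-mono-<-≤ (ℚ.+-monoˡ-< (w x b′) (P-strict q hq))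
            (subst (f b′ t ≤_) (ℚ.+-identityˡ (cost p)) (potential-bound p e′ eT done))
          strict (inj₂ (inj₁ (d≢fromℕ , _))) = contradiction refl d≢fromℕ
          strict (inj₂ (inj₂ hp)) = ℚ.+-mono-≤-< (ℚ.+-monoˡ-≤ (w x b′) (P-lower q))
            (subst (f b′ t <_) (ℚ.+-identityˡ (cost p)) (potential-bound-strict p e′ eT done (inj₂ hp)))

    module _ {m : ℕ} {P : Peg → Peg → ℚ} (P-lower : LowerBound m P) (P-nonneg : ∀ a b → 0ℚ ≤ P a b)
             (P-triangle : ∀ a b c → P a c ≤ P a b + P b c) {x z y b : Peg} where

      private
        module Pot = Potential P P-lower (λ x z → Cˢ P x z y b) {y} {b} (λ z → ℚ.≤-reflexive (Cˢ-≡ P y z b))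
                               (λ z → Cˢ-step P P-nonneg P-triangle z y b)

      Cˢ-lower-bound : ∀ {S T : Config (suc m)} (p : Path S T) → S ≡ tower m z ∷ʳ x → T ≡ tower m b ∷ʳ y →
                       Cˢ P x z y b ≤ cost p
      Cˢ-lower-bound p eS eT = subst (Cˢ P x z y b ≤_) (ℚ.+-identityˡ (cost p)) (Pot.potential-bound p eS eT done)

      Cˢ-lower-bound-strict : ∀ {i j} → StrictLowerBound i j m P →
                              ∀ {S T : Config (suc m)} (p : Path S T) → S ≡ tower m z ∷ʳ x → T ≡ tower m b ∷ʳ y →
                              HasSmallStep i j p → Cˢ P x z y b < cost p
      Cˢ-lower-bound-strict P-strict p eS eT h =
        subst (Cˢ P x z y b <_) (ℚ.+-identityˡ (cost p)) (Pot.potential-bound-strict P-strict p eS eT done (inj₂ h))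

    lower-bound⇒C-triangle : ∀ {m} → LowerBound m (C m) → ∀ a b c → C m a c ≤ C m a b + C m b c
    lower-bound⇒C-triangle {m} lower a b c = begin
      C m a c                                                 ≤⟨ lower (optimal-path m a b ++ optimal-path m b c) ⟩
      cost (optimal-path m a b ++ optimal-path m b c)         ≡⟨ cost-++ (optimal-path m a b) (optimal-path m b c) ⟩
      cost (optimal-path m a b) + cost (optimal-path m b c)   ≡⟨ cong₂ _+_ (cost-optimal-path m a b) (cost-optimal-path m b c) ⟩
      C m a b + C m b c                                       ∎
      where open ℚ.≤-Reasoning

    C-lower-bound : ∀ m → LowerBound m (C m)
    C-lower-bound zero    q         = cost-nonneg q
    C-lower-bound (suc m) {a} {b} p = Cˢ-lower-bound (C-lower-bound m) (C-nonneg m)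
      (lower-bound⇒C-triangle (C-lower-bound m)) p (replicate-∷ʳ m a) (replicate-∷ʳ m b)

    C-triangle : ∀ m a b c → C m a c ≤ C m a b + C m b c
    C-triangle m = lower-bound⇒C-triangle (C-lower-bound m)

    C-suc≤direct : ∀ m {a b c} → a ≢ b → c ≢ a → c ≢ b → C (suc m) a b ≤ direct (C m) a a b b c
    C-suc≤direct m {a} {b} {c} a≢b c≢a c≢b = subst (_≤ direct (C m) a a b b c) (sym (C-suc m a≢b c≢a c≢b))
      (ℚ.p⊓q≤p (direct (C m) a a b b c) (detour (C m) a a b b c))

    C-suc≤detour : ∀ m {a b c} → a ≢ b → c ≢ a → c ≢ b → C (suc m) a b ≤ detour (C m) a a b b c
    C-suc≤detour m {a} {b} {c} a≢b c≢a c≢b = subst (_≤ detour (C m) a a b b c) (sym (C-suc m a≢b c≢a c≢b))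
      (ℚ.p⊓q≤q (direct (C m) a a b b c) (detour (C m) a a b b c))

    C-mono : ∀ m a b → C m a b ≤ C (suc m) a b
    C-mono m a b = Cˢ-≥ (C m) (C-nonneg m) (C-triangle m) a a b b

    C-via≤detour : ∀ m {a b c} → a ≢ b → c ≢ a → c ≢ b → C m a c + C m c b ≤ detour (C m) a a b b c

    C-via≤C-suc : ∀ m {a b c} → a ≢ b → c ≢ a → c ≢ b → C m a c + C m c b ≤ C (suc m) a b
    C-via≤C-suc m {a} {b} {c} a≢b c≢a c≢b =
      subst (C m a c + C m c b ≤_) (sym (C-suc m a≢b c≢a c≢b))
        (ℚ.⊓-glb (ℚ.+-monoˡ-≤ (C m c b) (p≤p+q (C m a c) (w≥0 a b a≢b))) (C-via≤detour m a≢b c≢a c≢b))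

    C-via≤detour zero {a} {b} {c} a≢b c≢a c≢b = subst (_≤ 0ℚ + w a c + 0ℚ + w c b + 0ℚ) (ℚ.+-identityˡ 0ℚ)
      (+-nonneg (+-nonneg (+-nonneg (+-nonneg ℚ.≤-refl (w≥0 a c (≢-sym c≢a))) ℚ.≤-refl) (w≥0 c b c≢b)) ℚ.≤-refl)
    C-via≤detour (suc m) {a} {b} {c} a≢b c≢a c≢b = begin
      P a c + P c b
        ≤⟨ ℚ.+-mono-≤ (C-suc≤direct m (≢-sym c≢a) (≢-sym a≢b) (≢-sym c≢b))
                      (C-suc≤direct m c≢b (≢-sym c≢a) a≢b) ⟩
      Q a b + w a c + Q b c + (Q c a + w c b + Q a b)
        ≡⟨ solve 5 (λ A B D E F → A :+ B :+ D :+ (E :+ F :+ A) := A :+ B :+ (D :+ E) :+ F :+ A)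
             refl (Q a b) (w a c) (Q b c) (Q c a) (w c b) ⟩
      Q a b + w a c + (Q b c + Q c a) + w c b + Q a b
        ≤⟨ ℚ.+-mono-≤ (ℚ.+-monoˡ-≤ (w c b) (ℚ.+-mono-≤ (ℚ.+-monoˡ-≤ (w a c) (C-mono m a b))
                                                       (C-via≤C-suc m (≢-sym a≢b) c≢b c≢a)))
                      (C-mono m a b) ⟩
      P a b + w a c + P b a + w c b + P a b
        ∎
      where
      open ℚ.≤-Reasoning
      P = C (suc m)
      Q = C m

    DetourWins : ℕ → Peg → Peg → Peg → Set
    DetourWins m i j k = detour (C m) i i j j k < direct (C m) i i j j k

    C-suc-detour : ∀ m {i j k} → i ≢ j → k ≢ i → k ≢ j → DetourWins m i j k →
                   C (suc m) i j ≡ detour (C m) i i j j k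
    C-suc-detour m i≢j k≢i k≢j wins = trans (C-suc m i≢j k≢i k≢j) (ℚ.p≥q⇒p⊓q≡q (ℚ.<⇒≤ wins))

    module _ {i j k : Peg} (i≢j : i ≢ j) (k≢i : k ≢ i) (k≢j : k ≢ j) where

      private
        j≢i = ≢-sym i≢j
        i≢k = ≢-sym k≢i
        j≢k = ≢-sym k≢j

      direct-optimality-persists : ∀ m → C (suc m) i j ≡ direct (C m) i i j j k →
                                   direct (C (suc m)) i i j j k ≤ detour (C (suc m)) i i j j k
      direct-optimality-persists m P≡direct = begin
        P i k + w i j + P k j
          ≤⟨ ℚ.+-mono-≤ (ℚ.+-monoˡ-≤ (w i j) (C-suc≤direct m i≢k j≢i j≢k)) (C-suc≤direct m k≢j i≢k i≢j) ⟩
        Q i j + w i k + Q j k + w i j + (Q k i + w k j + Q i j)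
          ≡⟨ solve 6 (λ A B D E F G → A :+ B :+ D :+ E :+ (F :+ G :+ A) := A :+ A :+ (D :+ F) :+ B :+ G :+ E)
                refl (Q i j) (w i k) (Q j k) (w i j) (Q k i) (w k j) ⟩
        Q i j + Q i j + (Q j k + Q k i) + w i k + w k j + w i j
          ≤⟨ ℚ.+-mono-≤ (ℚ.+-monoˡ-≤ (w k j) (ℚ.+-monoˡ-≤ (w i k) (ℚ.+-mono-≤ (ℚ.+-mono-≤ triangle triangle)
                                                                         (C-via≤C-suc m j≢i k≢j k≢i))))
                        (p≤p+q (w i j) (w≥0 i j i≢j)) ⟩
        Q i k + Q k j + (Q i k + Q k j) + P j i + w i k + w k j + (w i j + w i j)
          ≡⟨ solve 6 (λ A B D E F G → A :+ B :+ (A :+ B) :+ D :+ E :+ F :+ (G :+ G) := A :+ G :+ B :+ E :+ D :+ F :+ (A :+ G :+ B))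
                refl (Q i k) (Q k j) (P j i) (w i k) (w k j) (w i j) ⟩
        direct Q i i j j k + w i k + P j i + w k j + direct Q i i j j k
          ≡⟨ cong (λ u → u + w i k + P j i + w k j + u) P≡direct ⟨
        P i j + w i k + P j i + w k j + P i j ∎
        where
        open ℚ.≤-Reasoning
        P = C (suc m)
        Q = C m
        triangle = C-triangle m i k j

      DetourWins-pred : ∀ m → DetourWins (suc m) i j k → DetourWins m i j k
      DetourWins-pred m wins with detour (C m) i i j j k ℚ.<? direct (C m) i i j j k
      ... | yes detour<direct = detour<direct
      ... | no  detour≮direct =
        contradiction (ℚ.<-≤-trans wins (direct-optimality-persists m C-suc≡direct)) (ℚ.<-irrefl refl)
        where
        C-suc≡direct : C (suc m) i j ≡ direct (C m) i i j j k
        C-suc≡direct = trans (C-suc m i≢j k≢i k≢j) (ℚ.p≤q⇒p⊓q≡p (ℚ.≮⇒≥ detour≮direct))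

      DetourWins⇒C-via≤ : ∀ m → DetourWins m i j k → C m i k + C m k j ≤ C m i j + C m i j + C m j i
      DetourWins⇒C-via≤ zero    _    = ℚ.≤-refl
      DetourWins⇒C-via≤ (suc m) wins = begin
        P i k + P k j
          ≤⟨ ℚ.+-mono-≤ (C-suc≤direct m i≢k j≢i j≢k) (C-suc≤direct m k≢j i≢k i≢j) ⟩
        Q i j + w i k + Q j k + (Q k i + w k j + Q i j)
          ≡⟨ solve 5 (λ A B D E F → A :+ B :+ D :+ (E :+ F :+ A) := A :+ B :+ F :+ A :+ (D :+ E))
                refl (Q i j) (w i k) (Q j k) (Q k i) (w k j) ⟩
        Q i j + w i k + w k j + Q i j + (Q j k + Q k i)
          ≤⟨ ℚ.+-mono-≤ (ℚ.+-mono-≤ moves≤P (C-mono m i j)) (C-via≤C-suc m j≢i k≢j k≢i) ⟩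
        P i j + P i j + P j i ∎
        where
        open ℚ.≤-Reasoning
        P = C (suc m)
        Q = C m
        moves≤P : Q i j + w i k + w k j ≤ P i j
        moves≤P = begin
          Q i j + w i k + w k j                    ≤⟨ p≤p+q _ (+-nonneg (C-nonneg m j i) (C-nonneg m i j)) ⟩
          Q i j + w i k + w k j + (Q j i + Q i j)  ≡⟨ solve 4 (λ A B D E → A :+ B :+ D :+ (E :+ A) := A :+ B :+ E :+ D :+ A)
                                                        refl (Q i j) (w i k) (w k j) (Q j i) ⟩
          detour Q i i j j k                       ≡⟨ C-suc-detour m i≢j k≢i k≢j (DetourWins-pred m wins) ⟨
          P i j                                    ∎

      DetourWins⇒w-pos : ∀ m → DetourWins m i j k → 0ℚ < w i j
      DetourWins⇒w-pos m wins = +-cancelʳ-< 0ℚ (w i j) (Q i k + Q k j) (begin-strict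
        0ℚ + (Q i k + Q k j)
          ≤⟨ ℚ.+-mono-≤ (+-nonneg (w≥0 i k i≢k) (w≥0 k j k≢j)) (DetourWins⇒C-via≤ m wins) ⟩
        w i k + w k j + (Q i j + Q i j + Q j i)
          ≡⟨ solve 4 (λ A B D E → A :+ B :+ (D :+ D :+ E) := D :+ A :+ E :+ B :+ D) refl (w i k) (w k j) (Q i j) (Q j i) ⟩
        detour Q i i j j k
          <⟨ wins ⟩
        direct Q i i j j k
          ≡⟨ solve 3 (λ A B D → A :+ B :+ D := B :+ (A :+ D)) refl (Q i k) (w i j) (Q k j) ⟩
        w i j + (Q i k + Q k j) ∎)
        where
        open ℚ.≤-Reasoning
        Q = C m

    -- Solutions that move a disc from i to j

    C-semi-lower-bound : ∀ m {S T : Config (suc m)} (p : Path S T) {x z y b} →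
                         S ≡ tower m z ∷ʳ x → T ≡ tower m b ∷ʳ y → Cˢ (C m) x z y b ≤ cost p
    C-semi-lower-bound m p = Cˢ-lower-bound (C-lower-bound m) (C-nonneg m) (C-triangle m) p

    module _ {i j : Peg} (i≢j : i ≢ j) where

      private
        k = third i j
        k≢i = third-≢ˡ i≢j
        k≢j = third-≢ʳ i≢j
        j≢i = ≢-sym i≢j
        i≢k = ≢-sym k≢i
        j≢k = ≢-sym k≢j

      split-at-move : ∀ {m} {S T : Config (suc m)} (p : Path S T) → HasStep i j p →
                      HasSmallStep i j p ⊎
                      Σ[ p₁ ∈ Path S (tower m k ∷ʳ i) ] Σ[ p₂ ∈ Path (tower m k ∷ʳ j) T ]
                        cost p ≡ cost p₁ + w i j + cost p₂
      split-at-move {m} (step {S} d b l e p) (inj₁ (Sd≡i , refl)) with view d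
      ... | ‵inject₁ d′ = inj₁ (inj₁ ((λ eq → fromℕ≢inject₁ (sym eq)) , Sd≡i , refl))
      ... | ‵fromℕ with initLast S
      ...   | s , x , refl with Legal-largest⁻¹ {x = x} {s = s} l | trans (sym (lookup-∷ʳ-fromℕ s x)) Sd≡i
      ...     | _ , refl | refl with trans (sym e) ([]≔-∷ʳ-fromℕ (tower m k) i j)
      ...       | refl =
        inj₂ (done , p , cong (_+ cost p) (trans (cong (λ a → w a j) Sd≡i) (sym (ℚ.+-identityˡ (w i j)))))
      split-at-move (step {S} d b l e p) (inj₂ h) with split-at-move p h
      ... | inj₁ small              = inj₁ (inj₂ small)
      ... | inj₂ (p₁ , p₂ , p-cost) = inj₂ (step d b l e p₁ , p₂ , (begin
        w (lookup S d) b + cost p                           ≡⟨ cong (w (lookup S d) b +_) p-cost ⟩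
        w (lookup S d) b + (cost p₁ + w i j + cost p₂)      ≡⟨ solve 4 (λ A B D E → A :+ (B :+ D :+ E) := A :+ B :+ D :+ E)
                                                                 refl (w (lookup S d) b) (cost p₁) (w i j) (cost p₂) ⟩
        w (lookup S d) b + cost p₁ + w i j + cost p₂        ∎))
        where open ≡-Reasoning

      data PairCase : Peg → Peg → Set where
        same   : ∀ {a} → PairCase a a
        into-i : ∀ {a} → PairCase a i
        from-j : ∀ {b} → PairCase j b
        i-to-j : PairCase i j
        i-to-k : PairCase i k
        k-to-j : PairCase k j

      pair-case : ∀ a b → PairCase a b
      pair-case a b with a ≟ b | b ≟ i | a ≟ j
      ... | yes refl | _        | _        = same
      ... | no _     | yes refl | _        = into-i
      ... | no _     | no _     | yes refl = from-j
      ... | no a≢b   | no b≢i   | no a≢j with a ≟ i | b ≟ j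
      ...   | yes refl | yes refl = i-to-j
      ...   | yes refl | no b≢j with third-unique i≢j b≢i b≢j
      ...     | refl = i-to-k
      pair-case a b | no a≢b | no b≢i | no a≢j | no a≢i | yes refl with third-unique i≢j a≢i a≢j
      ...     | refl = k-to-j
      pair-case a b | no a≢b | no b≢i | no a≢j | no a≢i | no b≢j =
        contradiction (trans (third-unique i≢j a≢i a≢j) (sym (third-unique i≢j b≢i b≢j))) a≢b

      module _ (m : ℕ) (wins : DetourWins m i j k) where

        private
          Q = C m

          w-pos : 0ℚ < w i j
          w-pos = DetourWins⇒w-pos i≢j k≢i k≢j m wins

          Before After : Peg → Set
          Before a = Path (tower (suc m) a) (tower m k ∷ʳ i)
          After  b = Path (tower m k ∷ʳ j) (tower (suc m) b)

          before-semi : ∀ {a} (p₁ : Before a) → Cˢ Q a a i k ≤ cost p₁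
          before-semi {a} p₁ = C-semi-lower-bound m p₁ (replicate-∷ʳ m a) refl

          after-semi : ∀ {b} (p₂ : After b) → Cˢ Q j k b b ≤ cost p₂
          after-semi {b} p₂ = C-semi-lower-bound m p₂ refl (replicate-∷ʳ m b)

          before : ∀ {a} (p₁ : Before a) → Q a k ≤ cost p₁
          before {a} p₁ = ℚ.≤-trans (Cˢ-≥ Q (C-nonneg m) (C-triangle m) a a i k) (before-semi p₁)

          after : ∀ {b} (p₂ : After b) → Q k b ≤ cost p₂
          after {b} p₂ = ℚ.≤-trans (Cˢ-≥ Q (C-nonneg m) (C-triangle m) j k b b) (after-semi p₂)

          cost-lift-optimal : ∀ {a b x} {S T : Config (suc m)} (eS : S ≡ tower m a ∷ʳ x) (eT : T ≡ tower m b ∷ʳ x) →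
                              cost (lift (optimal-path m a b) eS eT) ≡ Q a b
          cost-lift-optimal {a} {b} eS eT = trans (cost-lift (optimal-path m a b) eS eT) (cost-optimal-path m a b)

        same-case : ∀ {a} (p₁ : Before a) (p₂ : After a) → C (suc m) a a < cost p₁ + w i j + cost p₂
        same-case {a} p₁ p₂ = subst (_< cost p₁ + w i j + cost p₂) (sym (C-diag (suc m) a))
          (x≤p+q⇒x<p+r+q (cost p₁) (cost p₂) (+-nonneg (cost-nonneg p₁) (cost-nonneg p₂)) w-pos)

        into-i-case : ∀ {a} (p₁ : Before a) (p₂ : After i) → C (suc m) a i < cost p₁ + w i j + cost p₂
        into-i-case {a} p₁ p₂ = x≤p+q⇒x<p+r+q (cost p₁) (cost p₂) (begin
          C (suc m) a i         ≤⟨ C-lower-bound (suc m) (p₁ ++ back) ⟩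
          cost (p₁ ++ back)     ≡⟨ cost-++ p₁ back ⟩
          cost p₁ + cost back   ≡⟨ cong (cost p₁ +_) (cost-lift-optimal refl (replicate-∷ʳ m i)) ⟩
          cost p₁ + Q k i       ≤⟨ ℚ.+-monoʳ-≤ (cost p₁) (after p₂) ⟩
          cost p₁ + cost p₂     ∎) w-pos
          where
          open ℚ.≤-Reasoning
          back = lift (optimal-path m k i) refl (replicate-∷ʳ m i)

        from-j-case : ∀ {b} (p₁ : Before j) (p₂ : After b) → C (suc m) j b < cost p₁ + w i j + cost p₂
        from-j-case {b} p₁ p₂ = x≤p+q⇒x<p+r+q (cost p₁) (cost p₂) (begin
          C (suc m) j b          ≤⟨ C-lower-bound (suc m) (forth ++ p₂) ⟩
          cost (forth ++ p₂)     ≡⟨ cost-++ forth p₂ ⟩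
          cost forth + cost p₂   ≡⟨ cong (_+ cost p₂) (cost-lift-optimal (replicate-∷ʳ m j) refl) ⟩
          Q j k + cost p₂        ≤⟨ ℚ.+-monoˡ-≤ (cost p₂) (before p₁) ⟩
          cost p₁ + cost p₂      ∎) w-pos
          where
          open ℚ.≤-Reasoning
          forth = lift (optimal-path m j k) (replicate-∷ʳ m j) refl

        i-to-j-case : (p₁ : Before i) (p₂ : After j) → C (suc m) i j < cost p₁ + w i j + cost p₂
        i-to-j-case p₁ p₂ = begin-strict
          C (suc m) i j              ≤⟨ C-suc≤detour m i≢j k≢i k≢j ⟩
          detour Q i i j j k         <⟨ wins ⟩
          Q i k + w i j + Q k j      ≤⟨ ℚ.+-mono-≤ (ℚ.+-monoˡ-≤ (w i j) (before p₁)) (after p₂) ⟩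
          cost p₁ + w i j + cost p₂  ∎
          where open ℚ.≤-Reasoning

        i-to-k-case : (p₁ : Before i) (p₂ : After k) → C (suc m) i k < cost p₁ + w i j + cost p₂
        i-to-k-case p₁ p₂ = begin-strict
          C (suc m) i k
            ≤⟨ C-suc≤direct m i≢k j≢i j≢k ⟩
          Q i j + w i k + Q j k
            <⟨ <-⊓ (Q i k + w i j +_) (direct Q j k k k i) (detour Q j k k k i) via-direct via-detour ⟩
          Q i k + w i j + (direct Q j k k k i ⊓ detour Q j k k k i)
            ≡⟨ cong (Q i k + w i j +_) (Cˢ-≢ Q k k j≢k i≢j i≢k) ⟨
          Q i k + w i j + Cˢ Q j k k k
            ≤⟨ ℚ.+-mono-≤ (ℚ.+-monoˡ-≤ (w i j) (before p₁)) (after-semi p₂) ⟩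
          cost p₁ + w i j + cost p₂ ∎
          where
          open ℚ.≤-Reasoning
          via-direct : Q i j + w i k + Q j k < Q i k + w i j + (Q k i + w j k + Q i k)
          via-direct = +-cancelʳ-< _ _ (Q i k + Q k j) (begin-strict
            Q i j + w i k + Q j k + (Q i k + Q k j)
              ≤⟨ ℚ.+-mono-≤ (ℚ.+-monoʳ-≤ (Q i j + w i k) (C-triangle m j i k))
                            (ℚ.+-monoʳ-≤ (Q i k) (C-triangle m k i j)) ⟩
            Q i j + w i k + (Q j i + Q i k) + (Q i k + (Q k i + Q i j))
              ≤⟨ p≤p+q _ (+-nonneg (w≥0 k j k≢j) (w≥0 j k j≢k)) ⟩
            Q i j + w i k + (Q j i + Q i k) + (Q i k + (Q k i + Q i j)) + (w k j + w j k)
              ≡⟨ solve 7 (λ A B D E F G H → A :+ B :+ (D :+ E) :+ (E :+ (F :+ A)) :+ (G :+ H)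
                                              := A :+ B :+ D :+ G :+ A :+ (E :+ F :+ H :+ E))
                    refl (Q i j) (w i k) (Q j i) (Q i k) (Q k i) (w k j) (w j k) ⟩
            detour Q i i j j k + (Q i k + Q k i + w j k + Q i k)
              <⟨ ℚ.+-monoˡ-< (Q i k + Q k i + w j k + Q i k) wins ⟩
            direct Q i i j j k + (Q i k + Q k i + w j k + Q i k)
              ≡⟨ solve 5 (λ A B D E F → A :+ B :+ D :+ (A :+ E :+ F :+ A) := A :+ B :+ (E :+ F :+ A) :+ (A :+ D))
                    refl (Q i k) (w i j) (Q k j) (Q k i) (w j k) ⟩
            Q i k + w i j + (Q k i + w j k + Q i k) + (Q i k + Q k j) ∎)
          via-detour : Q i j + w i k + Q j k < Q i k + w i j + (Q k k + w j i + Q k j + w i k + Q j k)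
          via-detour = begin-strict
            Q i j + w i k + Q j k
              ≤⟨ ℚ.+-monoˡ-≤ (Q j k) (ℚ.+-monoˡ-≤ (w i k) (C-triangle m i k j)) ⟩
            Q i k + Q k j + w i k + Q j k
              ≡⟨ ℚ.+-identityˡ _ ⟨
            0ℚ + (Q i k + Q k j + w i k + Q j k)
              <⟨ ℚ.+-monoˡ-< _ w-pos ⟩
            w i j + (Q i k + Q k j + w i k + Q j k)
              ≤⟨ p≤p+q _ (+-nonneg (C-nonneg m k k) (w≥0 j i j≢i)) ⟩
            w i j + (Q i k + Q k j + w i k + Q j k) + (Q k k + w j i)
              ≡⟨ solve 7 (λ A B D E F G H → A :+ (B :+ D :+ E :+ F) :+ (G :+ H) := B :+ A :+ (G :+ H :+ D :+ E :+ F))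
                    refl (w i j) (Q i k) (Q k j) (w i k) (Q j k) (Q k k) (w j i) ⟩
            Q i k + w i j + (Q k k + w j i + Q k j + w i k + Q j k) ∎

        k-to-j-case : (p₁ : Before k) (p₂ : After j) → C (suc m) k j < cost p₁ + w i j + cost p₂
        k-to-j-case p₁ p₂ = begin-strict
          C (suc m) k j
            ≤⟨ C-suc≤direct m k≢j i≢k i≢j ⟩
          Q k i + w k j + Q i j
            <⟨ <-⊓ (λ u → u + w i j + Q k j) (direct Q k k i k j) (detour Q k k i k j) via-direct via-detour ⟩
          direct Q k k i k j ⊓ detour Q k k i k j + w i j + Q k j
            ≡⟨ cong (λ u → u + w i j + Q k j) (Cˢ-≢ Q k k k≢i j≢k j≢i) ⟨
          Cˢ Q k k i k + w i j + Q k j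
            ≤⟨ ℚ.+-mono-≤ (ℚ.+-monoˡ-≤ (w i j) (before-semi p₁)) (after p₂) ⟩
          cost p₁ + w i j + cost p₂ ∎
          where
          open ℚ.≤-Reasoning
          via-direct : Q k i + w k j + Q i j < Q k j + w k i + Q j k + w i j + Q k j
          via-direct = +-cancelʳ-< _ _ (Q i k + Q k j) (begin-strict
            Q k i + w k j + Q i j + (Q i k + Q k j)
              ≤⟨ ℚ.+-mono-≤ (ℚ.+-monoˡ-≤ (Q i j) (ℚ.+-monoˡ-≤ (w k j) (C-triangle m k j i)))
                            (ℚ.+-monoˡ-≤ (Q k j) (C-triangle m i j k)) ⟩
            Q k j + Q j i + w k j + Q i j + (Q i j + Q j k + Q k j)
              ≤⟨ p≤p+q _ (+-nonneg (w≥0 i k i≢k) (w≥0 k i k≢i)) ⟩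
            Q k j + Q j i + w k j + Q i j + (Q i j + Q j k + Q k j) + (w i k + w k i)
              ≡⟨ solve 7 (λ A B D E F G H → A :+ B :+ D :+ E :+ (E :+ F :+ A) :+ (G :+ H)
                                              := E :+ G :+ B :+ D :+ E :+ (A :+ F :+ A :+ H))
                    refl (Q k j) (Q j i) (w k j) (Q i j) (Q j k) (w i k) (w k i) ⟩
            detour Q i i j j k + (Q k j + Q j k + Q k j + w k i)
              <⟨ ℚ.+-monoˡ-< (Q k j + Q j k + Q k j + w k i) wins ⟩
            direct Q i i j j k + (Q k j + Q j k + Q k j + w k i)
              ≡⟨ solve 5 (λ A B D E F → A :+ B :+ D :+ (D :+ E :+ D :+ F) := D :+ F :+ E :+ B :+ D :+ (A :+ D))
                    refl (Q i k) (w i j) (Q k j) (Q j k) (w k i) ⟩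
            Q k j + w k i + Q j k + w i j + Q k j + (Q i k + Q k j) ∎)
          via-detour : Q k i + w k j + Q i j < Q k i + w k j + Q i k + w j i + Q k k + w i j + Q k j
          via-detour = begin-strict
            Q k i + w k j + Q i j
              ≤⟨ ℚ.+-monoʳ-≤ (Q k i + w k j) (C-triangle m i k j) ⟩
            Q k i + w k j + (Q i k + Q k j)
              ≡⟨ ℚ.+-identityˡ _ ⟨
            0ℚ + (Q k i + w k j + (Q i k + Q k j))
              <⟨ ℚ.+-monoˡ-< _ w-pos ⟩
            w i j + (Q k i + w k j + (Q i k + Q k j))
              ≤⟨ p≤p+q _ (+-nonneg (w≥0 j i j≢i) (C-nonneg m k k)) ⟩
            w i j + (Q k i + w k j + (Q i k + Q k j)) + (w j i + Q k k)
              ≡⟨ solve 7 (λ A B D E F G H → A :+ (B :+ D :+ (E :+ F)) :+ (G :+ H) := B :+ D :+ E :+ G :+ H :+ A :+ F)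
                    refl (w i j) (Q k i) (w k j) (Q i k) (Q k j) (w j i) (Q k k) ⟩
            Q k i + w k j + Q i k + w j i + Q k k + w i j + Q k j ∎

        largest-move-bound : ∀ {a b} (p₁ : Before a) (p₂ : After b) → C (suc m) a b < cost p₁ + w i j + cost p₂
        largest-move-bound {a} {b} p₁ p₂ with pair-case a b
        ... | same   = same-case p₁ p₂
        ... | into-i = into-i-case p₁ p₂
        ... | from-j = from-j-case p₁ p₂
        ... | i-to-j = i-to-j-case p₁ p₂
        ... | i-to-k = i-to-k-case p₁ p₂
        ... | k-to-j = k-to-j-case p₁ p₂

        C-strict-step : StrictLowerBound i j m (C m) → StrictLowerBound i j (suc m) (C (suc m))
        C-strict-step strict {a} {b} p h with split-at-move p h
        ... | inj₁ small              = Cˢ-lower-bound-strict (C-lower-bound m) (C-nonneg m) (C-triangle m) strict p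
                                          (replicate-∷ʳ m a) (replicate-∷ʳ m b) small
        ... | inj₂ (p₁ , p₂ , p-cost) = subst (C (suc m) a b <_) (sym p-cost) (largest-move-bound p₁ p₂)

      C-strict-lower-bound : ∀ m → DetourWins m i j k → StrictLowerBound i j (suc m) (C (suc m))
      C-strict-lower-bound zero    wins = C-strict-step 0 wins λ { done () ; (step () _ _ _ _) _ }
      C-strict-lower-bound (suc m) wins =
        C-strict-step (suc m) wins (C-strict-lower-bound m (DetourWins-pred i≢j k≢i k≢j m wins))

    C≤walk-cost : ∀ {m a b c} (p : Walk w (tower m a) (tower m b) c) → C m a b ≤ c
    C≤walk-cost {m} {a} {b} p = subst (C m a b ≤_) (cost-fromWalk p) (C-lower-bound m (fromWalk p))

    Optimal⇒≤C : ∀ {m a b c} (p : Walk w (tower m a) (tower m b) c) → Optimal w m a b p → c ≤ C m a b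
    Optimal⇒≤C {m} {a} {b} _ p-optimal =
      ℚ.≤-trans (p-optimal (toWalk (optimal-path m a b))) (ℚ.≤-reflexive (cost-optimal-path m a b))

    IsMinCost⇒≡C : ∀ {m a b c} → IsMinCost w m a b c → c ≡ C m a b
    IsMinCost⇒≡C (p , p-optimal) = ℚ.≤-antisym (Optimal⇒≤C p p-optimal) (C≤walk-cost p)

    cost≡C⇒Optimal : ∀ {m a b} (p : Path (tower m a) (tower m b)) → cost p ≡ C m a b → Optimal w m a b (toWalk p)
    cost≡C⇒Optimal p p-cost q = subst (_≤ _) (sym p-cost) (C≤walk-cost q)

    module _ (n : ℕ) {i j k : Peg} (i≢j : i ≢ j) (k≢i : k ≢ i) (k≢j : k ≢ j) where

      NoOptimalSolutionMoves : Peg → Peg → Set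
      NoOptimalSolutionMoves a b = ∀ {c} (p : Walk w (tower (suc n) i) (tower (suc n) j) c) →
                                   Optimal w (suc n) i j p → ¬ HasMove w a b p

      DetourWins⇒no-optimal-move : DetourWins n i j k → NoOptimalSolutionMoves i j
      DetourWins⇒no-optimal-move wins p p-optimal has-move with third-unique i≢j k≢i k≢j
      ... | refl = ℚ.<-irrefl refl (ℚ.<-≤-trans C<c (Optimal⇒≤C p p-optimal))
        where
        C<c = subst (C (suc n) i j <_) (cost-fromWalk p)
                (C-strict-lower-bound i≢j n wins (fromWalk p) (HasStep-fromWalk p has-move))

      no-optimal-move⇒DetourWins : NoOptimalSolutionMoves i j → DetourWins n i j k
      no-optimal-move⇒DetourWins none with third-unique i≢j k≢i k≢j
      ... | refl with detour (C n) i i j j k ℚ.<? direct (C n) i i j j k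
      ...   | yes wins  = wins
      ...   | no  loses =
        contradiction (HasMove-toWalk p (HasStep-direct-path i≢j optimal₁ optimal₂)) (none (toWalk p) (cost≡C⇒Optimal p p-cost))
        where
        optimal₁ = optimal-path n i k
        optimal₂ = optimal-path n k j
        p = direct-path i≢j optimal₁ optimal₂
        p-cost : cost p ≡ C (suc n) i j
        p-cost = begin
          cost p                                  ≡⟨ cost-direct-path i≢j optimal₁ optimal₂ ⟩
          cost optimal₁ + w i j + cost optimal₂   ≡⟨ cong₂ (λ u v → u + w i j + v)
                                                             (cost-optimal-path n i k) (cost-optimal-path n k j) ⟩
          direct (C n) i i j j k                  ≡⟨ trans (C-suc n i≢j k≢i k≢j) (ℚ.p≤q⇒p⊓q≡p (ℚ.≮⇒≥ loses)) ⟨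
          C (suc n) i j                           ∎
          where open ≡-Reasoning

      WeightInequality : Set
      WeightInequality = w i k + w k j + (0ℚ ⊔ (C n i j + C n i j + C n j i - C n i k - C n k j)) < w i j

      CostEquation : Set
      CostEquation = C (suc n) i j ≡ C n i j + C n i j + C n j i + w i k + w k j

      DetourWins⇔ : DetourWins n i j k ⇔ WeightInequality
      DetourWins⇔ = mk⇔ to from
        where
        detour≡ : detour (C n) i i j j k ≡ w i k + w k j + (C n i j + C n i j + C n j i - C n i k - C n k j) + (C n i k + C n k j)
        detour≡ = solve 6 (λ A B E F H I → A :+ H :+ B :+ I :+ A := H :+ I :+ (A :+ A :+ B :- E :- F) :+ (E :+ F))
                    refl (C n i j) (C n j i) (C n i k) (C n k j) (w i k) (w k j)
        direct≡ : direct (C n) i i j j k ≡ w i j + (C n i k + C n k j)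
        direct≡ = solve 3 (λ A B E → A :+ B :+ E := B :+ (A :+ E)) refl (C n i k) (w i j) (C n k j)
        rearranged : DetourWins n i j k → w i k + w k j + (C n i j + C n i j + C n j i - C n i k - C n k j) < w i j
        rearranged wins = +-cancelʳ-< _ _ (C n i k + C n k j) (subst₂ _<_ detour≡ direct≡ wins)
        to : DetourWins n i j k → WeightInequality
        to wins = subst (λ u → w i k + w k j + u < w i j) (sym (ℚ.p≤q⇒p⊔q≡q excess≥0)) (rearranged wins)
          where excess≥0 = p+q≤r⇒0≤r-p-q (DetourWins⇒C-via≤ i≢j k≢i k≢j n wins)
        from : WeightInequality → DetourWins n i j k
        from condition = subst₂ _<_ (sym detour≡) (sym direct≡) (ℚ.+-monoˡ-< (C n i k + C n k j)
          (ℚ.≤-<-trans (ℚ.+-monoʳ-≤ (w i k + w k j) (ℚ.p≤q⊔p 0ℚ (C n i j + C n i j + C n j i - C n i k - C n k j)))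
                       condition))

      DetourWins⇒CostEquation : DetourWins n i j k → CostEquation
      DetourWins⇒CostEquation wins = trans (C-suc-detour n i≢j k≢i k≢j wins)
        (solve 4 (λ A B E F → A :+ E :+ B :+ F :+ A := A :+ A :+ B :+ E :+ F) refl (C n i j) (C n j i) (w i k) (w k j))

      no-optimal-move⇔ : NoOptimalSolutionMoves i j ⇔ (WeightInequality × CostEquation)
      no-optimal-move⇔ = mk⇔ to from
        where
        to : NoOptimalSolutionMoves i j → WeightInequality × CostEquation
        to none = Equivalence.to DetourWins⇔ wins , DetourWins⇒CostEquation wins
          where wins = no-optimal-move⇒DetourWins none
        from : WeightInequality × CostEquation → NoOptimalSolutionMoves i j
        from (inequality , _) = DetourWins⇒no-optimal-move (Equivalence.from DetourWins⇔ inequality)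

lemma1 : (w : Weights) → (∀ (a b : Peg) → a ≢ b → 0ℚ ≤ w a b) →
    (n : ℕ) (i j k : Peg) → i ≢ j → k ≢ i → k ≢ j →
    (cij cji cik ckj cn1 : ℚ) →
    IsMinCost w n i j cij → IsMinCost w n j i cji →
    IsMinCost w n i k cik → IsMinCost w n k j ckj →
    IsMinCost w (suc n) i j cn1 →
    ((∀ {c : ℚ} (p : Walk w (tower (suc n) i) (tower (suc n) j) c) →
        Optimal w (suc n) i j p → ¬ HasMove w i j p)
     ⇔
     ((w i k + w k j + (0ℚ ⊔ (cij + cij + cji - cik - ckj)) < w i j)
      × (cn1 ≡ cij + cij + cji + w i k + w k j)))
lemma1 w w≥0 n i j k i≢j k≢i k≢j _ _ _ _ _ cij-min cji-min cik-min ckj-min cn1-min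
  with IsMinCost⇒≡C w w≥0 cij-min | IsMinCost⇒≡C w w≥0 cji-min | IsMinCost⇒≡C w w≥0 cik-min
     | IsMinCost⇒≡C w w≥0 ckj-min | IsMinCost⇒≡C w w≥0 cn1-min
... | refl | refl | refl | refl | refl = no-optimal-move⇔ w w≥0 n i≢j k≢i k≢j
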